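{- $\mathrm{SLT}_1\subsetneq\mathrm{RL}_2^V$.
   Context: A right-linear grammar is $(N,T,P,S)$ with rules of the form $A\to wB$ or $A\to w$, $A,B\in N$, $w\in T^*$; $\mathrm{RL}_n^V$ is the family of regular languages generated by some right-linear grammar with at most $n$ non-terminal symbols. A language $L$ over an alphabet $V$ is strictly locally $1$-testable (family $\mathrm{SLT}_1$) if there are sets $B,I,E\subseteq V$ and a set $F\subseteq\{\lambda\}$ such that $L$ consists of the words of $F$ together with exactly those words $a_1a_2\cdots a_n$ ($n\geq 1$, $a_i\in V$) for which $a_1\in B$, $a_{j+1}\in I$ for every $j$ with $1\leq j\leq n-2$, and $a_n\in E$. -}

module Defs where

open import Data.Nat using (ℕ; _≤_)
open import Data.Fin using (Fin)
open import Data.Fin.Subset using (Subset; _∈_)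
open import Data.List using (List; []; _∷_; _++_)
open import Data.List.Membership.Propositional renaming (_∈_ to _∈ˡ_)
open import Data.Maybe using (Maybe; just; nothing)
open import Data.Bool using (Bool; true)
open import Data.Product using (Σ; _×_; _,_)
open import Data.Unit using (⊤)
open import Relation.Binary.PropositionalEquality using (_≡_)
open import Function.Bundles using (_⇔_)

Word : ℕ → Set
Word k = List (Fin k)

Language : ℕ → Set₁
Language k = Word k → Set

-- A production A → w B (next = just B) or A → w (next = nothing),
-- with nonterminals Fin m and terminals Fin k.
record Rule (m k : ℕ) : Set where
  constructor rule
  field
    lhs  : Fin m
    rhs  : Word k
    next : Maybe (Fin m)

record RLGrammar (m k : ℕ) : Set where
  constructor grammar
  field
    rules : List (Rule m k)
    start : Fin m

data Derives {m k : ℕ} (G : RLGrammar m k) : Fin m → Word k → Set where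
  term : ∀ {A w} → rule A w nothing ∈ˡ RLGrammar.rules G → Derives G A w
  step : ∀ {A B w v} → rule A w (just B) ∈ˡ RLGrammar.rules G →
         Derives G B v → Derives G A (w ++ v)

Generated : ∀ {m k} → RLGrammar m k → Language k
Generated G w = Derives G (RLGrammar.start G) w

_≐_ : ∀ {k} → Language k → Language k → Set
L ≐ L' = ∀ w → L w ⇔ L' w

InRL : (n : ℕ) → ∀ {k} → Language k → Set
InRL n {k} L = Σ ℕ λ m → m ≤ n × Σ (RLGrammar m k) λ G → L ≐ Generated G

-- Strictly locally 1-testable languages given by (B, I, E, F);
-- F ⊆ {λ} is encoded by a Bool (true iff λ ∈ F).
module _ {k : ℕ} (B I E : Subset k) (F : Bool) where
  -- for a_j a_{j+1} ... a_n (j ≥ 2): a_j .. a_{n-1} ∈ I, a_n ∈ E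
  SLTtail : Fin k → Word k → Set
  SLTtail a []       = a ∈ E
  SLTtail a (b ∷ bs) = a ∈ I × SLTtail b bs

  -- the word after a_1 (a_1 itself already checked against B)
  SLTrest : Fin k → Word k → Set
  SLTrest a []       = a ∈ E
  SLTrest a (b ∷ bs) = SLTtail b bs

  SLTLang : Language k
  SLTLang []       = F ≡ true
  SLTLang (a ∷ as) = a ∈ B × SLTrest a as

InSLT1 : ∀ {k} → Language k → Set
InSLT1 {k} L = Σ (Subset k) λ B → Σ (Subset k) λ I → Σ (Subset k) λ E →
               Σ Bool λ F → L ≐ SLTLang B I E F

-- An SLT₁ language needs only two nonterminals: S reads the first letter
-- (checked against B, and also against E when it is the whole word), and T
-- loops over the letters of I until it reads a final letter of E.  Conversely
-- {aa} lies in RL₁ but not in SLT₁, since a strictly 1-testable language only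
-- sees that aa starts with a letter of B and ends with a letter of E, and those
-- are exactly the conditions for the word a.
module Submission where

open import Defs
open import Data.Nat as ℕ using (ℕ; _≤_; s≤s; z≤n)
open import Data.Nat.Properties using (≤-refl; ≤-trans)
open import Data.Bool using (Bool; true)
open import Data.Bool.Properties using () renaming (_≟_ to _≟ᵇ_)
open import Data.Empty using (⊥)
open import Data.Fin using (Fin; zero; suc)
open import Data.Fin.Subset using (Subset; _∈_)
open import Data.Fin.Subset.Properties using (_∈?_)
open import Data.List using (List; []; _∷_; concatMap; filter; map; allFin)
open import Data.List.Relation.Unary.Any as Any using (here; there)
open import Data.List.Membership.Propositional using () renaming (_∈_ to _∈ˡ_)
open import Data.List.Membership.Propositional.Properties
  using (∈-allFin; ∈-concatMap⁺; ∈-map∘filter⁺; ∈-map∘filter⁻)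
open import Data.Maybe using (just; nothing)
open import Data.Product using (Σ; _×_; _,_)
open import Function using (_∘_)
open import Function.Bundles using (mk⇔; Equivalence)
open import Function.Properties.Equivalence using () renaming (trans to ⇔-trans)
open import Relation.Binary.PropositionalEquality using (_≡_; refl)
open import Relation.Nullary using (¬_)
open import Relation.Nullary.Decidable using (map′; _×-dec_)
open import Relation.Unary using (Decidable)

open Equivalence using (to; from)

InRL-mono : ∀ {m n k} {L : Language k} → m ≤ n → InRL m L → InRL n L
InRL-mono m≤n (j , j≤m , G , L≐G) = j , ≤-trans j≤m m≤n , G , L≐G

InRL-resp-≐ : ∀ {n k} {L L′ : Language k} → L ≐ L′ → InRL n L′ → InRL n L
InRL-resp-≐ L≐L′ (m , m≤n , G , L′≐G) = m , m≤n , G , λ w → ⇔-trans (L≐L′ w) (L′≐G w)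

singleton-InRL₁ : ∀ {k} (u : Word k) → InRL 1 (_≡ u)
singleton-InRL₁ {k} u = 1 , ≤-refl , G , λ w → mk⇔ (λ { refl → term (here refl) }) derives-only-u
  where
  G : RLGrammar 1 k
  G = grammar (rule zero u nothing ∷ []) zero

  derives-only-u : ∀ {w} → Derives G zero w → w ≡ u
  derives-only-u (term (here refl)) = refl
  derives-only-u (term (there ()))
  derives-only-u (step (here ()) _)
  derives-only-u (step (there ()) _)

module SLT₁Grammar {k : ℕ} (B I E : Subset k) (F : Bool) where

  S T : Fin 2
  S = zero
  T = suc zero

  data Candidate : Set where
    accept-λ               : Candidate
    single enter loop exit : Fin k → Candidate

  toRule : Candidate → Rule 2 k
  toRule accept-λ   = rule S [] nothing
  toRule (single a) = rule S (a ∷ []) nothing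
  toRule (enter a)  = rule S (a ∷ []) (just T)
  toRule (loop a)   = rule T (a ∷ []) (just T)
  toRule (exit a)   = rule T (a ∷ []) nothing

  letterCandidates : Fin k → List Candidate
  letterCandidates a = single a ∷ enter a ∷ loop a ∷ exit a ∷ []

  candidates : List Candidate
  candidates = accept-λ ∷ concatMap letterCandidates (allFin k)

  ∈-letterCandidates : ∀ a {c} → c ∈ˡ letterCandidates a → c ∈ˡ candidates
  ∈-letterCandidates a c∈ = there (∈-concatMap⁺ _ (Any.map (λ { refl → c∈ }) (∈-allFin a)))

  ∈-candidates : ∀ c → c ∈ˡ candidates
  ∈-candidates accept-λ   = here refl
  ∈-candidates (single a) = ∈-letterCandidates a (here refl)
  ∈-candidates (enter a)  = ∈-letterCandidates a (there (here refl))
  ∈-candidates (loop a)   = ∈-letterCandidates a (there (there (here refl)))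
  ∈-candidates (exit a)   = ∈-letterCandidates a (there (there (there (here refl))))

  data Permitted : Rule 2 k → Set where
    empty      : F ≡ true → Permitted (rule S [] nothing)
    first-last : ∀ {a} → a ∈ B → a ∈ E → Permitted (rule S (a ∷ []) nothing)
    first      : ∀ {a} → a ∈ B → Permitted (rule S (a ∷ []) (just T))
    interior   : ∀ {a} → a ∈ I → Permitted (rule T (a ∷ []) (just T))
    last       : ∀ {a} → a ∈ E → Permitted (rule T (a ∷ []) nothing)

  permitted? : Decidable (Permitted ∘ toRule)
  permitted? accept-λ   = map′ empty (λ { (empty e) → e }) (F ≟ᵇ true)
  permitted? (single a) = map′ (λ (b , e) → first-last b e) (λ { (first-last b e) → b , e })
                               (a ∈? B ×-dec a ∈? E)
  permitted? (enter a)  = map′ first (λ { (first b) → b }) (a ∈? B)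
  permitted? (loop a)   = map′ interior (λ { (interior i) → i }) (a ∈? I)
  permitted? (exit a)   = map′ last (λ { (last e) → e }) (a ∈? E)

  rules : List (Rule 2 k)
  rules = map toRule (filter permitted? candidates)

  G : RLGrammar 2 k
  G = grammar rules S

  permitted : ∀ {r} → r ∈ˡ rules → Permitted r
  permitted r∈ with c , _ , refl , pc ← ∈-map∘filter⁻ toRule permitted? {xs = candidates} r∈ = pc

  permitted-∈-rules : ∀ c → Permitted (toRule c) → toRule c ∈ˡ rules
  permitted-∈-rules c p = ∈-map∘filter⁺ toRule permitted? (c , ∈-candidates c , refl , p)

  Tail : Word k → Set
  Tail []       = ⊥
  Tail (b ∷ bs) = SLTtail B I E F b bs

  cons-Tail : ∀ {a v} → a ∈ I → Tail v → Tail (a ∷ v)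
  cons-Tail {v = _ ∷ _} a∈I t = a∈I , t

  Tail⇒SLTrest : ∀ {a} v → Tail v → SLTrest B I E F a v
  Tail⇒SLTrest (_ ∷ _) t = t

  Tail-sound : ∀ {w} → Derives G T w → Tail w
  Tail-sound (term r∈) with permitted r∈
  ... | last a∈E = a∈E
  Tail-sound (step r∈ d) with permitted r∈
  ... | interior a∈I = cons-Tail a∈I (Tail-sound d)

  sound : ∀ {w} → Derives G S w → SLTLang B I E F w
  sound (term r∈) with permitted r∈
  ... | empty λ∈F          = λ∈F
  ... | first-last a∈B a∈E = a∈B , a∈E
  sound (step {v = v} r∈ d) with permitted r∈
  ... | first a∈B = a∈B , Tail⇒SLTrest v (Tail-sound d)

  Tail-complete : ∀ b bs → SLTtail B I E F b bs → Derives G T (b ∷ bs)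
  Tail-complete b []       b∈E       = term (permitted-∈-rules (exit b) (last b∈E))
  Tail-complete b (c ∷ cs) (b∈I , t) =
    step (permitted-∈-rules (loop b) (interior b∈I)) (Tail-complete c cs t)

  complete : ∀ w → SLTLang B I E F w → Derives G S w
  complete []           λ∈F         = term (permitted-∈-rules accept-λ (empty λ∈F))
  complete (a ∷ [])     (a∈B , a∈E) = term (permitted-∈-rules (single a) (first-last a∈B a∈E))
  complete (a ∷ b ∷ bs) (a∈B , t)   =
    step (permitted-∈-rules (enter a) (first a∈B)) (Tail-complete b bs t)

  generates : SLTLang B I E F ≐ Generated G
  generates w = mk⇔ (complete w) sound

SLT₁⊆RL₂ : ∀ {k} (L : Language k) → InSLT1 L → InRL 2 L
SLT₁⊆RL₂ L (B , I , E , F , L≐SLT) =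
  InRL-resp-≐ L≐SLT (2 , ≤-refl , SLT₁Grammar.G B I E F , SLT₁Grammar.generates B I E F)

twice-∉SLT₁ : ∀ {k} (a : Fin k) → ¬ InSLT1 (_≡ a ∷ a ∷ [])
twice-∉SLT₁ a (B , I , E , F , L≐SLT) with from (L≐SLT (a ∷ [])) (to (L≐SLT (a ∷ a ∷ [])) refl)
... | ()

lemma14 : (k : ℕ) →
    ((L : Language k) → InSLT1 L → InRL 2 L) ×
    (1 ≤ k → Σ (Language k) λ L → InRL 2 L × ¬ InSLT1 L)
lemma14 ℕ.zero    = SLT₁⊆RL₂ , λ ()
lemma14 (ℕ.suc _) = SLT₁⊆RL₂ , λ _ →
  (_≡ zero ∷ zero ∷ []) , InRL-mono (s≤s z≤n) (singleton-InRL₁ (zero ∷ zero ∷ [])) , twice-∉SLT₁ zero
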